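{- Let $n\ge 1$ and let $\sigma$ be an edge 2-coloring of the complete graph $K_n$. Suppose some color $c$ used by $\sigma$ satisfies $V(K_n^c)\subsetneq V(K_n)$ and there are exactly two colors $c'\neq c$ with $V(K_n^c)\cap V(K_n^{c'})\neq\emptyset$. Then $\sigma$ uses exactly three colors, and each of these three colors $d$ satisfies $V(K_n^d)\subsetneq V(K_n)$ and $V(K_n^d)$ intersects $V(K_n^{d'})$ for exactly two colors $d'\neq d$.
   Context: An edge 2-coloring of a graph is an assignment of colors to its edges such that each vertex is incident to edges of at most 2 distinct colors. For a color $c$, the color subgraph $K_n^c$ is the subgraph of $K_n$ induced by the edges of color $c$; its vertex set $V(K_n^c)$ consists of the vertices incident to at least one edge of color $c$. -}

module Defs where

open import Data.Nat using (ℕ)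
open import Data.Fin using (Fin)
open import Data.Product using (Σ; _×_; ∃)
open import Data.Sum using (_⊎_)
open import Relation.Nullary using (¬_)
open import Relation.Binary.PropositionalEquality using (_≡_; _≢_)

-- An edge colouring of K_n with colours in ℕ: a symmetric function on
-- pairs of vertices; only the values on pairs i ≢ j (the edges) matter.
record EdgeColouring (n : ℕ) : Set where
  field
    col : Fin n → Fin n → ℕ
    sym : ∀ i j → col i j ≡ col j i
open EdgeColouring public

-- Edge 2-colouring: every vertex is incident to edges of at most 2
-- distinct colours, i.e. no three edges at v have pairwise distinct colours.
Is2Colouring : ∀ {n} → EdgeColouring n → Set
Is2Colouring {n} σ =
  ∀ (v a b c : Fin n) → a ≢ v → b ≢ v → c ≢ v →
    (col σ v a ≡ col σ v b) ⊎ (col σ v a ≡ col σ v c) ⊎ (col σ v b ≡ col σ v c)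

Uses : ∀ {n} → EdgeColouring n → ℕ → Set
Uses {n} σ c = Σ (Fin n) λ i → Σ (Fin n) λ j → i ≢ j × col σ i j ≡ c

InV : ∀ {n} → EdgeColouring n → ℕ → Fin n → Set
InV {n} σ c v = Σ (Fin n) λ u → u ≢ v × col σ v u ≡ c

-- V(K_n^c) ⊊ V(K_n)  (inclusion is automatic; strictness = some vertex missing)
ProperV : ∀ {n} → EdgeColouring n → ℕ → Set
ProperV {n} σ c = Σ (Fin n) λ v → ¬ InV σ c v

Meets : ∀ {n} → EdgeColouring n → ℕ → ℕ → Set
Meets {n} σ c d = Σ (Fin n) λ v → InV σ c v × InV σ d v

ExactlyTwoMeets : ∀ {n} → EdgeColouring n → ℕ → Set
ExactlyTwoMeets σ c =
  Σ ℕ λ d₁ → Σ ℕ λ d₂ →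
    d₁ ≢ d₂ × d₁ ≢ c × d₂ ≢ c × Meets σ c d₁ × Meets σ c d₂ ×
    (∀ d → d ≢ c → Meets σ c d → (d ≡ d₁) ⊎ (d ≡ d₂))

-- Pick a vertex w missing from V(c). A vertex a of V(c) carries an edge of
-- colour c and the edge aw, whose colour is not c; so a sees exactly the two
-- colours c and col a w, and col a w is one of the two colours d₁, d₂ meeting c
-- (witnessed by vertices v₁, v₂ with col vᵢ w = dᵢ). A vertex x outside V(c)
-- receives colour col a w on each edge xa with a ∈ V(c), so it sees d₁ and d₂
-- and nothing else. Hence c, d₁, d₂ are the only colours, v₂ ∉ V(d₁) and
-- v₁ ∉ V(d₂), and each dᵢ meets c (at vᵢ) and the other (at w).
module Submission where

open import Defs
open import Data.Nat using (ℕ; _≥_)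
open import Data.Nat.Properties using () renaming (_≟_ to _≟ℕ_)
open import Data.Fin using (Fin) renaming (_≟_ to _≟F_)
open import Data.Fin.Properties using (any?)
open import Data.Product using (Σ; _×_; _,_)
open import Data.Sum using (_⊎_; inj₁; inj₂)
import Data.Sum as Sum
open import Function using (_∘_)
open import Data.Empty using (⊥-elim)
open import Relation.Nullary using (¬_; Dec; yes; no)
open import Relation.Nullary.Decidable using (_×-dec_; ¬?)
open import Relation.Binary.PropositionalEquality using (_≡_; _≢_; refl; subst; ≢-sym)
import Relation.Binary.PropositionalEquality as ≡

module _ {n : ℕ} (σ : EdgeColouring n) where

  InV? : ∀ d v → Dec (InV σ d v)
  InV? d v = any? λ u → ¬? (u ≟F v) ×-dec (col σ v u ≟ℕ d)

  InV⇒Uses : ∀ {d v} → InV σ d v → Uses σ d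
  InV⇒Uses {v = v} (u , u≢v , e) = v , u , ≢-sym u≢v , e

  edge⇒InV : ∀ {d u v} → u ≢ v → col σ v u ≡ d → InV σ d u
  edge⇒InV {u = u} {v} u≢v e = v , ≢-sym u≢v , ≡.trans (sym σ u v) e

  ∈V⇒≢∉V : ∀ {d a x} → InV σ d a → ¬ InV σ d x → a ≢ x
  ∈V⇒≢∉V a∈ x∉ a≡x = x∉ (subst (InV σ _) a≡x a∈)

  incident-colours : Is2Colouring σ → ∀ {v a b} → a ≢ v → b ≢ v →
    col σ v a ≢ col σ v b →
    ∀ {u} → u ≢ v → col σ v u ≡ col σ v a ⊎ col σ v u ≡ col σ v b
  incident-colours is2 a≢v b≢v a≉b u≢v with is2 _ _ _ _ a≢v b≢v u≢v
  ... | inj₁ e = ⊥-elim (a≉b e)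
  ... | inj₂ (inj₁ e) = inj₁ (≡.sym e)
  ... | inj₂ (inj₂ e) = inj₂ (≡.sym e)

module OutsideVertex {n : ℕ} (σ : EdgeColouring n) (is2 : Is2Colouring σ)
  {c : ℕ} {w : Fin n} (w∉ : ¬ InV σ c w) where

  w≢ : ∀ {a} → InV σ c a → w ≢ a
  w≢ a∈ = ≢-sym (∈V⇒≢∉V σ a∈ w∉)

  colour-to-w≢c : ∀ {a} → InV σ c a → col σ a w ≢ c
  colour-to-w≢c a∈ e = w∉ (edge⇒InV σ (w≢ a∈) e)

  ∈V-edge : ∀ {a u} → InV σ c a → u ≢ a → col σ a u ≡ c ⊎ col σ a u ≡ col σ a w
  ∈V-edge a∈@(_ , a'≢a , e) u≢a
    with incident-colours σ is2 a'≢a (w≢ a∈)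
           (λ e' → colour-to-w≢c a∈ (≡.trans (≡.sym e') e)) u≢a
  ... | inj₁ e' = inj₁ (≡.trans e' e)
  ... | inj₂ e' = inj₂ e'

  ∈V-colour : ∀ {a d} → InV σ c a → InV σ d a → d ≢ c → col σ a w ≡ d
  ∈V-colour a∈ (_ , u≢a , e) d≢c with ∈V-edge a∈ u≢a
  ... | inj₁ e' = ⊥-elim (d≢c (≡.trans (≡.sym e) e'))
  ... | inj₂ e' = ≡.trans (≡.sym e') e

  ∈V⇒w∈V : ∀ {a d} → InV σ c a → InV σ d a → d ≢ c → InV σ d w
  ∈V⇒w∈V a∈ a∈d d≢c = edge⇒InV σ (w≢ a∈) (∈V-colour a∈ a∈d d≢c)

  ∉V-other : ∀ {a d d'} → InV σ c a → InV σ d' a → d ≢ c → d' ≢ c → d ≢ d' →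
    ¬ InV σ d a
  ∉V-other a∈ a∈d' d≢c d'≢c d≢d' (_ , u≢a , e) with ∈V-edge a∈ u≢a
  ... | inj₁ e' = d≢c (≡.trans (≡.sym e) e')
  ... | inj₂ e' = d≢d' (≡.trans (≡.sym e) (≡.trans e' (∈V-colour a∈ a∈d' d'≢c)))

  meets-colour-to-w : ∀ {a} → InV σ c a → Meets σ c (col σ a w)
  meets-colour-to-w a∈ = _ , a∈ , (w , w≢ a∈ , refl)

  edge-from-outside : ∀ {a d x} → InV σ c a → InV σ d a → d ≢ c → ¬ InV σ c x →
    col σ x a ≡ d
  edge-from-outside {a} {x = x} a∈ a∈d d≢c x∉ with ∈V-edge a∈ (≢-sym (∈V⇒≢∉V σ a∈ x∉))
  ... | inj₁ e = ⊥-elim (x∉ (edge⇒InV σ (≢-sym (∈V⇒≢∉V σ a∈ x∉)) e))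
  ... | inj₂ e = ≡.trans (sym σ x a) (≡.trans e (∈V-colour a∈ a∈d d≢c))

  proper∧exactly-two-meets : ∀ {d d' a a'} → d ≢ d' → d ≢ c → d' ≢ c →
    InV σ c a → InV σ d a → InV σ c a' → InV σ d' a' →
    (∀ e → Uses σ e → e ≡ c ⊎ e ≡ d ⊎ e ≡ d') →
    ProperV σ d × ExactlyTwoMeets σ d
  proper∧exactly-two-meets {d} {d'} {a} {a'} d≢d' d≢c d'≢c a∈ a∈d a'∈ a'∈d' only =
      (a' , ∉V-other a'∈ a'∈d' d≢c d'≢c d≢d')
    , c , d' , ≢-sym d'≢c , ≢-sym d≢c , ≢-sym d≢d'
    , (a , a∈d , a∈) , (w , ∈V⇒w∈V a∈ a∈d d≢c , ∈V⇒w∈V a'∈ a'∈d' d'≢c)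
    , λ e e≢d (_ , _ , x∈e) → other e≢d (only e (InV⇒Uses σ x∈e))
    where
    other : ∀ {e} → e ≢ d → e ≡ c ⊎ e ≡ d ⊎ e ≡ d' → e ≡ c ⊎ e ≡ d'
    other _ (inj₁ e≡c) = inj₁ e≡c
    other e≢d (inj₂ (inj₁ e≡d)) = ⊥-elim (e≢d e≡d)
    other _ (inj₂ (inj₂ e≡d')) = inj₂ e≡d'

  module _ {d₁ d₂ v₁ v₂} (d₁≢d₂ : d₁ ≢ d₂) (d₁≢c : d₁ ≢ c) (d₂≢c : d₂ ≢ c)
    (v₁∈ : InV σ c v₁) (v₁∈d₁ : InV σ d₁ v₁) (v₂∈ : InV σ c v₂) (v₂∈d₂ : InV σ d₂ v₂)
    (unique : ∀ d → d ≢ c → Meets σ c d → d ≡ d₁ ⊎ d ≡ d₂) where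

    edge-colours : ∀ {x u} → u ≢ x → col σ x u ≡ c ⊎ col σ x u ≡ d₁ ⊎ col σ x u ≡ d₂
    edge-colours {x} u≢x with InV? σ c x
    ... | yes x∈ with ∈V-edge x∈ u≢x
    ...   | inj₁ e = inj₁ e
    ...   | inj₂ e = inj₂ (Sum.map (≡.trans e) (≡.trans e)
                                 (unique _ (colour-to-w≢c x∈) (meets-colour-to-w x∈)))
    edge-colours {x} u≢x | no x∉ =
      inj₂ (Sum.map (λ e → ≡.trans e to-v₁) (λ e → ≡.trans e to-v₂)
             (incident-colours σ is2 (∈V⇒≢∉V σ v₁∈ x∉) (∈V⇒≢∉V σ v₂∈ x∉)
               (λ e → d₁≢d₂ (≡.trans (≡.sym to-v₁) (≡.trans e to-v₂))) u≢x))
      where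
      to-v₁ = edge-from-outside v₁∈ v₁∈d₁ d₁≢c x∉
      to-v₂ = edge-from-outside v₂∈ v₂∈d₂ d₂≢c x∉

    uses⇒three : ∀ e → Uses σ e → e ≡ c ⊎ e ≡ d₁ ⊎ e ≡ d₂
    uses⇒three e (x , u , x≢u , colour) =
      subst (λ k → k ≡ c ⊎ k ≡ d₁ ⊎ k ≡ d₂) colour (edge-colours (≢-sym x≢u))

lemma3 : (n : ℕ) → n ≥ 1 → (σ : EdgeColouring n) → Is2Colouring σ →
    (c : ℕ) → Uses σ c → ProperV σ c → ExactlyTwoMeets σ c →
    Σ ℕ λ d₁ → Σ ℕ λ d₂ → Σ ℕ λ d₃ →
      d₁ ≢ d₂ × d₁ ≢ d₃ × d₂ ≢ d₃ ×
      Uses σ d₁ × Uses σ d₂ × Uses σ d₃ ×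
      (∀ d → Uses σ d → (d ≡ d₁) ⊎ (d ≡ d₂) ⊎ (d ≡ d₃)) ×
      (ProperV σ d₁ × ExactlyTwoMeets σ d₁) ×
      (ProperV σ d₂ × ExactlyTwoMeets σ d₂) ×
      (ProperV σ d₃ × ExactlyTwoMeets σ d₃)
lemma3 _ _ σ is2 c uses-c (w , w∉)
  c-meets@(d₁ , d₂ , d₁≢d₂ , d₁≢c , d₂≢c , (v₁ , v₁∈ , v₁∈d₁) , (v₂ , v₂∈ , v₂∈d₂) , unique) =
    c , d₁ , d₂ , ≢-sym d₁≢c , ≢-sym d₂≢c , d₁≢d₂
  , uses-c , InV⇒Uses σ v₁∈d₁ , InV⇒Uses σ v₂∈d₂ , only
  , ((w , w∉) , c-meets)
  , proper∧exactly-two-meets d₁≢d₂ d₁≢c d₂≢c v₁∈ v₁∈d₁ v₂∈ v₂∈d₂ only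
  , proper∧exactly-two-meets (≢-sym d₁≢d₂) d₂≢c d₁≢c v₂∈ v₂∈d₂ v₁∈ v₁∈d₁
      (λ e → Sum.map₂ Sum.swap ∘ only e)
  where
  open OutsideVertex σ is2 w∉
  only : ∀ e → Uses σ e → e ≡ c ⊎ e ≡ d₁ ⊎ e ≡ d₂
  only = uses⇒three d₁≢d₂ d₁≢c d₂≢c v₁∈ v₁∈d₁ v₂∈ v₂∈d₂ unique
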